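{- Let $G$ be the corona $H\circ K_1$ of a connected graph $H$ of order $n\geq 2$. Then $\gamma_{t[1,2]}(G)=\gamma_{[1,2]}(G)$ if and only if $H$ is a path or a cycle.
   Context: All graphs are finite, simple and undirected; $N(v)$ denotes the neighborhood of $v$. The corona $H\circ K_1$ is the graph obtained from $H$ by attaching to each vertex $v\in V(H)$ a new pendant vertex adjacent only to $v$. A set $S\subseteq V(G)$ is a $[1,2]$-set of $G$ if $1\leq |N(v)\cap S|\leq 2$ for every $v\in V(G)\setminus S$; $\gamma_{[1,2]}(G)$ is the minimum cardinality of a $[1,2]$-set. A set $S\subseteq V(G)$ is a total $[1,2]$-set of $G$ if $1\leq |N(v)\cap S|\leq 2$ for every $v\in V(G)$; $\gamma_{t[1,2]}(G)$ is the minimum cardinality of a total $[1,2]$-set, with $\gamma_{t[1,2]}(G)=+\infty$ if none exists. -}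

module Defs where

open import Data.Nat using (ℕ; _≤_; _+_; _%_)
open import Data.Bool using (Bool; true; false; _∧_; _∨_)
open import Data.Fin using (Fin; toℕ; splitAt)
open import Data.Fin.Properties using () renaming (_≟_ to _≟ᶠ_)
open import Data.Fin.Subset using (Subset; _∈_; _∉_; _∩_; ∣_∣)
open import Data.Vec using (tabulate)
open import Data.Sum using (inj₁; inj₂)
open import Data.Product using (Σ; _×_; ∃)
open import Relation.Binary.PropositionalEquality using (_≡_)
open import Relation.Nullary.Decidable using (⌊_⌋)
open import Function.Bundles using (_⤖_; Bijection)
import Data.Nat.Properties as ℕP

Adjacency : ℕ → Set
Adjacency m = Fin m → Fin m → Bool

record Graph (n : ℕ) : Set where
  field
    adj    : Adjacency n
    sym    : ∀ u v → adj u v ≡ adj v u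
    irrefl : ∀ v → adj v v ≡ false
open Graph public

N : ∀ {m} → Adjacency m → Fin m → Subset m
N A v = tabulate (A v)

degIn : ∀ {m} → Adjacency m → Subset m → Fin m → ℕ
degIn A S v = ∣ N A v ∩ S ∣

Is12Set : ∀ {m} → Adjacency m → Subset m → Set
Is12Set A S = ∀ v → v ∉ S → (1 ≤ degIn A S v) × (degIn A S v ≤ 2)

IsT12Set : ∀ {m} → Adjacency m → Subset m → Set
IsT12Set A S = ∀ v → (1 ≤ degIn A S v) × (degIn A S v ≤ 2)

IsMinCard : ∀ {m} → (Subset m → Set) → ℕ → Set
IsMinCard P k = (Σ _ λ S → P S × ∣ S ∣ ≡ k) × (∀ S → P S → k ≤ ∣ S ∣)

-- γ_{t[1,2]}(G) = γ_{[1,2]}(G): both are equal to the same natural number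
-- (in particular γ_{t[1,2]}(G) ≠ +∞; γ_{[1,2]}(G) is always finite).
GammaT12≡Gamma12 : ∀ {m} → Adjacency m → Set
GammaT12≡Gamma12 A = ∃ λ k → IsMinCard (Is12Set A) k × IsMinCard (IsT12Set A) k

-- Corona H ∘ K₁ on vertex set Fin (n + n): vertex i < n is vertex i of H,
-- vertex n + i is the pendant vertex attached to i.
corona : ∀ {n} → Graph n → Adjacency (n + n)
corona {n} H u v with splitAt n u | splitAt n v
... | inj₁ i | inj₁ j = adj H i j
... | inj₁ i | inj₂ j = ⌊ i ≟ᶠ j ⌋
... | inj₂ i | inj₁ j = ⌊ i ≟ᶠ j ⌋
... | inj₂ i | inj₂ j = false

data Reach {n} (G : Graph n) : Fin n → Fin n → Set where
  here : ∀ {u} → Reach G u u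
  step : ∀ {u v w} → adj G u v ≡ true → Reach G v w → Reach G u w

Connected : ∀ {n} → Graph n → Set
Connected G = ∀ u v → Reach G u v

pathAdj : ∀ n → Adjacency n
pathAdj n i j = ⌊ toℕ j ℕP.≟ Data.Nat.suc (toℕ i) ⌋ ∨ ⌊ toℕ i ℕP.≟ Data.Nat.suc (toℕ j) ⌋
  where import Data.Nat

-- Standard cycle C_n on Fin n (meaningful for n ≥ 3): i ~ j iff j ≡ i ± 1 mod n.
cycleAdj : ∀ n → Adjacency n
cycleAdj n i j = ⌊ toℕ j ℕP.≟ Data.Nat.suc (toℕ i) ⌋ ∨ ⌊ toℕ i ℕP.≟ Data.Nat.suc (toℕ j) ⌋
                 ∨ (⌊ Data.Nat.suc (toℕ i) ℕP.≟ n ⌋ ∧ ⌊ toℕ j ℕP.≟ 0 ⌋)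
                 ∨ (⌊ Data.Nat.suc (toℕ j) ℕP.≟ n ⌋ ∧ ⌊ toℕ i ℕP.≟ 0 ⌋)
  where import Data.Nat

IsoTo : ∀ {n} → Graph n → Adjacency n → Set
IsoTo {n} G B = Σ (Fin n ⤖ Fin n) λ σ →
  ∀ i j → adj G (Bijection.to σ i) (Bijection.to σ j) ≡ B i j

IsPath : ∀ {n} → Graph n → Set
IsPath {n} G = IsoTo G (pathAdj n)

IsCycle : ∀ {n} → Graph n → Set
IsCycle {n} G = (3 ≤ n) × IsoTo G (cycleAdj n)

-- A [1,2]-set S of H ∘ K₁ contains, for every vertex v of H, v or its pendant vertex, since a
-- pendant vertex outside S is dominated only by v; hence γ[1,2] ≥ n, with equality for S = V(H).
-- A total [1,2]-set must contain all of V(H), as every pendant vertex needs a neighbour in it, so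
-- each vertex of H has at most two neighbours in H: Δ(H) ≤ 2. Conversely, if Δ(H) ≤ 2 and H has no
-- isolated vertex, V(H) is itself a total [1,2]-set. So γt[1,2] = γ[1,2] exactly when Δ(H) ≤ 2.
-- Finally, a connected graph with Δ ≤ 2 on n ≥ 2 vertices is a path or a cycle: a non-backtracking
-- walk from a vertex of degree one (from any vertex, if all degrees are two) cannot close off a
-- proper part of the graph, so its first n vertices are distinct, and listing them in order is an
-- isomorphism onto the standard path or cycle.

module Submission where

open import Defs hiding (sym)
open import Data.Nat as ℕ using (ℕ; zero; suc; _+_; _∸_; _≤_; _<_; z≤n; s≤s)
import Data.Nat.Properties as ℕ
open import Data.Bool as Bool using (Bool; true; false; T)
open import Data.Bool.Properties using (T-≡; T-∨; T-∧)
open import Data.Fin as Fin using (Fin; zero; suc; toℕ; _↑ˡ_; _↑ʳ_; splitAt; punchOut)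
open import Data.Fin.Properties as Fin using (any?; injective⇒≤; punchOut-injective; toℕ-injective)
open import Data.Fin.Subset using (Subset; _∈_; _∉_; _∩_; ∣_∣; _-_; ⊤; ⊥; inside; outside)
open import Data.Fin.Subset.Properties
  using (x∈p⇒∣p-x∣<∣p∣; x∈p∧x≢y⇒x∈p-y; ∣⊤∣≡n; ∣⊥∣≡0; ∈⊤; x∈p∩q⁺; x∈p∩q⁻; _∈?_)
open import Data.Vec using ([]; _∷_; _++_; tabulate; here; there)
open import Data.Vec.Properties
  using (lookup∘tabulate; []=⇒lookup; lookup⇒[]=; lookup-replicate; lookup-++ˡ; lookup-++ʳ)
open import Data.Sum as Sum using (_⊎_; inj₁; inj₂)
open import Data.Product as Prod using (Σ; ∃; ∃₂; _×_; _,_; proj₁; proj₂)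
open import Function using (_∘_; id)
open import Function.Bundles using (_⇔_; mk⇔; Equivalence; _⤖_; mk⤖; Bijection)
open import Function.Definitions using (Injective; StrictlySurjective)
open import Function.Consequences.Propositional using (strictlySurjective⇒surjective)
open import Relation.Nullary using (¬_; Dec; yes; no; contradiction)
open import Relation.Nullary.Decidable using (⌊_⌋; toWitness; fromWitness; _×-dec_; ¬?)
open import Relation.Binary.Definitions using (tri<; tri≈; tri>)
open import Relation.Binary.PropositionalEquality

private variable
  k m n : ℕ

injective⇒strictlySurjective : ∀ {f : Fin n → Fin n} → Injective _≡_ _≡_ f → StrictlySurjective _≡_ f
injective⇒strictlySurjective {suc n} {f} f-inj y with any? (λ x → f x Fin.≟ y)
... | yes hit = hit
... | no miss = contradiction (injective⇒≤ punched-injective) (ℕ.1+n≰n {n})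
  where
  punched : Fin (suc n) → Fin n
  punched x = punchOut {i = y} {j = f x} (λ y≡fx → miss (x , sym y≡fx))
  punched-injective : Injective _≡_ _≡_ punched
  punched-injective = f-inj ∘ punchOut-injective {i = y} _ _

strictlySurjective⇒≤ : ∀ {f : Fin k → Fin n} → StrictlySurjective _≡_ f → n ≤ k
strictlySurjective⇒≤ {f = f} surj = injective⇒≤ section-injective
  where
  section-injective : Injective _≡_ _≡_ (proj₁ ∘ surj)
  section-injective {x} {y} eq = trans (sym (proj₂ (surj x))) (trans (cong f eq) (proj₂ (surj y)))

AtMostTwo : ∀ {a} {A : Set a} → (A → Set) → Set a
AtMostTwo P = ∀ {x y z} → P x → P y → P z → x ≡ y ⊎ x ≡ z ⊎ y ≡ z

AtMostTwo-mono : ∀ {a} {A : Set a} {P Q : A → Set} → (∀ {x} → P x → Q x) → AtMostTwo Q → AtMostTwo P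
AtMostTwo-mono P⊆Q two px py pz = two (P⊆Q px) (P⊆Q py) (P⊆Q pz)

functional-pair⇒AtMostTwo : ∀ {a} {A : Set a} {R S : A → Set} →
  (∀ {x y} → R x → R y → x ≡ y) → (∀ {x y} → S x → S y → x ≡ y) → AtMostTwo (λ x → R x ⊎ S x)
functional-pair⇒AtMostTwo R-fun S-fun (inj₁ rx) (inj₁ ry) _         = inj₁ (R-fun rx ry)
functional-pair⇒AtMostTwo R-fun S-fun (inj₂ sx) (inj₂ sy) _         = inj₁ (S-fun sx sy)
functional-pair⇒AtMostTwo R-fun S-fun (inj₁ rx) (inj₂ sy) (inj₁ rz) = inj₂ (inj₁ (R-fun rx rz))
functional-pair⇒AtMostTwo R-fun S-fun (inj₁ rx) (inj₂ sy) (inj₂ sz) = inj₂ (inj₂ (S-fun sy sz))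
functional-pair⇒AtMostTwo R-fun S-fun (inj₂ sx) (inj₁ ry) (inj₁ rz) = inj₂ (inj₂ (R-fun ry rz))
functional-pair⇒AtMostTwo R-fun S-fun (inj₂ sx) (inj₁ ry) (inj₂ sz) = inj₂ (inj₁ (S-fun sx sz))

x∈p⇒1≤∣p∣ : ∀ {p : Subset n} {x} → x ∈ p → 1 ≤ ∣ p ∣
x∈p⇒1≤∣p∣ x∈p = ℕ.≤-trans (s≤s z≤n) (x∈p⇒∣p-x∣<∣p∣ x∈p)

InjectionInto : Subset n → ℕ → Set
InjectionInto {n} p k = Σ (Fin k → Fin n) λ f → Injective _≡_ _≡_ f × (∀ i → f i ∈ p)

injection⇒≤∣p∣ : ∀ {p : Subset n} → InjectionInto p k → k ≤ ∣ p ∣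
injection⇒≤∣p∣ {k = zero} _ = z≤n
injection⇒≤∣p∣ {k = suc k} {p = p} (f , f-inj , f∈p) = ℕ.≤-trans (s≤s rest≤) (x∈p⇒∣p-x∣<∣p∣ (f∈p zero))
  where
  rest≤ : k ≤ ∣ p - f zero ∣
  rest≤ = injection⇒≤∣p∣ (f ∘ suc , Fin.suc-injective ∘ f-inj ,
            λ i → x∈p∧x≢y⇒x∈p-y (f∈p (suc i)) (λ eq → Fin.0≢1+n (sym (f-inj eq))))

≤∣p∣⇒injection : ∀ {p : Subset n} → k ≤ ∣ p ∣ → InjectionInto p k
≤∣p∣⇒injection {k = zero} _ = (λ ()) , (λ { {()} }) , λ ()
≤∣p∣⇒injection {k = suc k} {p = outside ∷ p} k<∣p∣
  with f , f-inj , f∈p ← ≤∣p∣⇒injection k<∣p∣ =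
  suc ∘ f , f-inj ∘ Fin.suc-injective , there ∘ f∈p
≤∣p∣⇒injection {k = suc k} {p = inside ∷ p} (s≤s k≤∣p∣)
  with f , f-inj , f∈p ← ≤∣p∣⇒injection k≤∣p∣ = g , g-inj , g∈
  where
  g : Fin (suc k) → Fin _
  g zero    = zero
  g (suc i) = suc (f i)
  g-inj : Injective _≡_ _≡_ g
  g-inj {zero}  {zero}  _  = refl
  g-inj {suc i} {suc j} eq = cong suc (f-inj (Fin.suc-injective eq))
  g∈ : ∀ i → g i ∈ inside ∷ p
  g∈ zero    = here
  g∈ (suc i) = there (f∈p i)

three-members⇒3≤∣p∣ : ∀ {p : Subset n} {x y z} → x ∈ p → y ∈ p → z ∈ p →
  x ≢ y → x ≢ z → y ≢ z → 3 ≤ ∣ p ∣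
three-members⇒3≤∣p∣ x∈p y∈p z∈p x≢y x≢z y≢z =
  ℕ.≤-trans (s≤s (ℕ.≤-trans (s≤s (x∈p⇒1≤∣p∣ z∈p-x-y)) (x∈p⇒∣p-x∣<∣p∣ y∈p-x))) (x∈p⇒∣p-x∣<∣p∣ x∈p)
  where
  y∈p-x   = x∈p∧x≢y⇒x∈p-y y∈p (x≢y ∘ sym)
  z∈p-x-y = x∈p∧x≢y⇒x∈p-y (x∈p∧x≢y⇒x∈p-y z∈p (x≢z ∘ sym)) (y≢z ∘ sym)

∣p∣≤2⇒AtMostTwo : ∀ {p : Subset n} → ∣ p ∣ ≤ 2 → AtMostTwo (_∈ p)
∣p∣≤2⇒AtMostTwo ∣p∣≤2 {x} {y} {z} x∈p y∈p z∈p with x Fin.≟ y | x Fin.≟ z | y Fin.≟ z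
... | yes x≡y | _       | _       = inj₁ x≡y
... | no  _   | yes x≡z | _       = inj₂ (inj₁ x≡z)
... | no  _   | no  _   | yes y≡z = inj₂ (inj₂ y≡z)
... | no  x≢y | no  x≢z | no  y≢z =
  contradiction (ℕ.≤-trans (three-members⇒3≤∣p∣ x∈p y∈p z∈p x≢y x≢z y≢z) ∣p∣≤2) (ℕ.<-irrefl refl)

AtMostTwo⇒∣p∣≤2 : ∀ {p : Subset n} → AtMostTwo (_∈ p) → ∣ p ∣ ≤ 2
AtMostTwo⇒∣p∣≤2 {p = p} two with ∣ p ∣ ℕ.≤? 2
... | yes ∣p∣≤2 = ∣p∣≤2
... | no ∣p∣≰2 with f , f-inj , f∈p ← ≤∣p∣⇒injection {k = 3} (ℕ.≰⇒> ∣p∣≰2)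
  with two (f∈p zero) (f∈p (suc zero)) (f∈p (suc (suc zero)))
... | inj₁ f0≡f1        = contradiction (f-inj f0≡f1) λ ()
... | inj₂ (inj₁ f0≡f2) = contradiction (f-inj f0≡f2) λ ()
... | inj₂ (inj₂ f1≡f2) = contradiction (f-inj f1≡f2) λ ()

∣p++q∣≡∣p∣+∣q∣ : ∀ (p : Subset m) (q : Subset n) → ∣ p ++ q ∣ ≡ ∣ p ∣ + ∣ q ∣
∣p++q∣≡∣p∣+∣q∣ []            q = refl
∣p++q∣≡∣p∣+∣q∣ (inside  ∷ p) q = cong suc (∣p++q∣≡∣p∣+∣q∣ p q)
∣p++q∣≡∣p∣+∣q∣ (outside ∷ p) q = ∣p++q∣≡∣p∣+∣q∣ p q

three-distinct⇒3≤n : ∀ {x y z : Fin n} → x ≢ y → x ≢ z → y ≢ z → 3 ≤ n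
three-distinct⇒3≤n {n} x≢y x≢z y≢z = subst (3 ≤_) (∣⊤∣≡n n) (three-members⇒3≤∣p∣ ∈⊤ ∈⊤ ∈⊤ x≢y x≢z y≢z)

MaxDegree≤2 : Adjacency n → Set
MaxDegree≤2 A = ∀ v → AtMostTwo (λ u → A v u ≡ true)

module Edges (H : Graph n) where

  infix 4 _~_
  _~_ : Fin n → Fin n → Set
  u ~ v = adj H u v ≡ true

  ~-sym : ∀ {u v} → u ~ v → v ~ u
  ~-sym {u} {v} u~v = trans (Graph.sym H v u) u~v

  ~-irrefl : ∀ {u v} → u ~ v → u ≢ v
  ~-irrefl {u} u~u refl = contradiction (trans (sym (irrefl H u)) u~u) λ ()

  neighbours-of : MaxDegree≤2 (adj H) → ∀ {w p q y} → p ≢ q → w ~ p → w ~ q → w ~ y → y ≡ p ⊎ y ≡ q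
  neighbours-of Δ≤2 p≢q w~p w~q w~y with Δ≤2 _ w~p w~q w~y
  ... | inj₁ p≡q        = contradiction p≡q p≢q
  ... | inj₂ (inj₁ p≡y) = inj₁ (sym p≡y)
  ... | inj₂ (inj₂ q≡y) = inj₂ (sym q≡y)

  reach-closed : (P : Fin n → Set) → (∀ {v w} → P v → v ~ w → P w) → ∀ {u v} → Reach H u v → P u → P v
  reach-closed P closed here         pu = pu
  reach-closed P closed (step u~w r) pu = reach-closed P closed r (closed pu u~w)

  connected⇒neighbour : 2 ≤ n → Connected H → ∀ u → ∃ (u ~_)
  connected⇒neighbour (s≤s (s≤s _)) conn u =
    first-step (conn u (Fin.punchIn u zero)) (Fin.punchInᵢ≢i u zero ∘ sym)
    where
    first-step : ∀ {v} → Reach H u v → u ≢ v → ∃ (u ~_)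
    first-step here         u≢u = contradiction refl u≢u
    first-step (step u~w _) _   = _ , u~w

PathStep : Fin n → Fin n → Set
PathStep i j = toℕ j ≡ suc (toℕ i) ⊎ toℕ i ≡ suc (toℕ j)

CyclicSucc : Fin n → Fin n → Set
CyclicSucc {n} i j = toℕ j ≡ suc (toℕ i) ⊎ (suc (toℕ i) ≡ n × toℕ j ≡ 0)

CycleStep : Fin n → Fin n → Set
CycleStep i j = CyclicSucc i j ⊎ CyclicSucc j i

PathStep⇒CycleStep : ∀ {i j : Fin n} → PathStep i j → CycleStep i j
PathStep⇒CycleStep = Sum.map inj₁ inj₁

CyclicSucc-functional : ∀ {i j k : Fin n} → CyclicSucc i j → CyclicSucc i k → j ≡ k
CyclicSucc-functional (inj₁ j≡1+i) (inj₁ k≡1+i) = toℕ-injective (trans j≡1+i (sym k≡1+i))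
CyclicSucc-functional {j = j} (inj₁ j≡1+i) (inj₂ (1+i≡n , _)) =
  contradiction (trans j≡1+i 1+i≡n) (ℕ.<⇒≢ (Fin.toℕ<n j))
CyclicSucc-functional {k = k} (inj₂ (1+i≡n , _)) (inj₁ k≡1+i) =
  contradiction (trans k≡1+i 1+i≡n) (ℕ.<⇒≢ (Fin.toℕ<n k))
CyclicSucc-functional (inj₂ (_ , j≡0)) (inj₂ (_ , k≡0)) = toℕ-injective (trans j≡0 (sym k≡0))

CyclicSucc-injective : ∀ {i j k : Fin n} → CyclicSucc j i → CyclicSucc k i → j ≡ k
CyclicSucc-injective (inj₁ i≡1+j) (inj₁ i≡1+k) = toℕ-injective (ℕ.suc-injective (trans (sym i≡1+j) i≡1+k))
CyclicSucc-injective (inj₁ i≡1+j) (inj₂ (_ , i≡0)) = contradiction (trans (sym i≡1+j) i≡0) λ ()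
CyclicSucc-injective (inj₂ (_ , i≡0)) (inj₁ i≡1+k) = contradiction (trans (sym i≡1+k) i≡0) λ ()
CyclicSucc-injective (inj₂ (1+j≡n , _)) (inj₂ (1+k≡n , _)) =
  toℕ-injective (ℕ.suc-injective (trans 1+j≡n (sym 1+k≡n)))

∨-introˡ : ∀ a b → T a → T (a Bool.∨ b)
∨-introˡ true _ _ = _

∨-introʳ : ∀ a b → T b → T (a Bool.∨ b)
∨-introʳ true  _ _  = _
∨-introʳ false _ tb = tb

T-pathAdj : ∀ {i j : Fin n} → T (pathAdj n i j) ⇔ PathStep i j
T-pathAdj {i = i} {j} = mk⇔ (Sum.map (toWitness {a? = up}) (toWitness {a? = down}) ∘ Equivalence.to T-∨)
                            (Equivalence.from T-∨ ∘ Sum.map (fromWitness {a? = up}) (fromWitness {a? = down}))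
  where
  up   = toℕ j ℕ.≟ suc (toℕ i)
  down = toℕ i ℕ.≟ suc (toℕ j)

T-cycleAdj : ∀ {i j : Fin n} → T (cycleAdj n i j) ⇔ CycleStep i j
T-cycleAdj {n} {i} {j} = mk⇔ to from
  where
  up   = toℕ j ℕ.≟ suc (toℕ i)
  down = toℕ i ℕ.≟ suc (toℕ j)
  i-last = suc (toℕ i) ℕ.≟ n
  j-last = suc (toℕ j) ℕ.≟ n
  i-first = toℕ i ℕ.≟ 0
  j-first = toℕ j ℕ.≟ 0
  to : T (cycleAdj n i j) → CycleStep i j
  to e with Equivalence.to T-∨ e
  ... | inj₁ u = inj₁ (inj₁ (toWitness {a? = up} u))
  ... | inj₂ e′ with Equivalence.to T-∨ e′
  ... | inj₁ d = inj₂ (inj₁ (toWitness {a? = down} d))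
  ... | inj₂ e″ with Equivalence.to T-∨ e″
  ... | inj₁ w = inj₁ (inj₂ (Prod.map (toWitness {a? = i-last}) (toWitness {a? = j-first}) (Equivalence.to T-∧ w)))
  ... | inj₂ w = inj₂ (inj₂ (Prod.map (toWitness {a? = j-last}) (toWitness {a? = i-first}) (Equivalence.to T-∧ w)))
  D₁ = ⌊ up ⌋
  D₂ = ⌊ down ⌋
  D₃ = ⌊ i-last ⌋ Bool.∧ ⌊ j-first ⌋
  D₄ = ⌊ j-last ⌋ Bool.∧ ⌊ i-first ⌋
  from : CycleStep i j → T (cycleAdj n i j)
  from (inj₁ (inj₁ u)) = ∨-introˡ D₁ _ (fromWitness u)
  from (inj₂ (inj₁ d)) = ∨-introʳ D₁ _ (∨-introˡ D₂ _ (fromWitness d))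
  from (inj₁ (inj₂ (i-last≡ , j-first≡))) = ∨-introʳ D₁ _ (∨-introʳ D₂ _ (∨-introˡ D₃ D₄
    (Equivalence.from T-∧ (fromWitness {a? = i-last} i-last≡ , fromWitness {a? = j-first} j-first≡))))
  from (inj₂ (inj₂ (j-last≡ , i-first≡))) = ∨-introʳ D₁ _ (∨-introʳ D₂ _ (∨-introʳ D₃ D₄
    (Equivalence.from T-∧ (fromWitness {a? = j-last} j-last≡ , fromWitness {a? = i-first} i-first≡))))

CycleStep-AtMostTwo : ∀ (i : Fin n) → AtMostTwo (CycleStep i)
CycleStep-AtMostTwo i = functional-pair⇒AtMostTwo {R = CyclicSucc i} {S = λ j → CyclicSucc j i}
  CyclicSucc-functional CyclicSucc-injective

cycleAdj-MaxDegree≤2 : MaxDegree≤2 (cycleAdj n)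
cycleAdj-MaxDegree≤2 i = AtMostTwo-mono (Equivalence.to T-cycleAdj ∘ Equivalence.from T-≡) (CycleStep-AtMostTwo i)

pathAdj-MaxDegree≤2 : MaxDegree≤2 (pathAdj n)
pathAdj-MaxDegree≤2 i = AtMostTwo-mono (PathStep⇒CycleStep ∘ Equivalence.to T-pathAdj ∘ Equivalence.from T-≡)
  (CycleStep-AtMostTwo i)

IsoTo⇒MaxDegree≤2 : ∀ {H : Graph n} {B} → IsoTo H B → MaxDegree≤2 B → MaxDegree≤2 (adj H)
IsoTo⇒MaxDegree≤2 {H = H} {B} (σ , σ-iso) Δ≤2 v {a} {b} {c} v~a v~b v~c
  with v′ , refl ← Bijection.strictlySurjective σ v | a′ , refl ← Bijection.strictlySurjective σ a
     | b′ , refl ← Bijection.strictlySurjective σ b | c′ , refl ← Bijection.strictlySurjective σ c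
  = Sum.map (cong to) (Sum.map (cong to) (cong to)) (Δ≤2 v′ (edge v~a) (edge v~b) (edge v~c))
  where
  open Bijection σ using (to)
  edge : ∀ {i j} → adj H (to i) (to j) ≡ true → B i j ≡ true
  edge {i} {j} e = trans (sym (σ-iso i j)) e

≡true⇔T⇒≡ : ∀ {a b} → a ≡ true ⇔ T b → a ≡ b
≡true⇔T⇒≡ {true}  {true}  _ = refl
≡true⇔T⇒≡ {true}  {false} a⇔b = contradiction (Equivalence.to a⇔b refl) λ ()
≡true⇔T⇒≡ {false} {true}  a⇔b = Equivalence.from a⇔b _
≡true⇔T⇒≡ {false} {false} _ = refl

IsoTo-intro : ∀ {H : Graph n} {B} {R : Fin n → Fin n → Set} (σ : Fin n ⤖ Fin n) →
  (∀ {i j} → adj H (Bijection.to σ i) (Bijection.to σ j) ≡ true ⇔ R i j) →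
  (∀ {i j} → T (B i j) ⇔ R i j) → IsoTo H B
IsoTo-intro σ H⇔R B⇔R = σ , λ i j → ≡true⇔T⇒≡ (mk⇔
  (Equivalence.from B⇔R ∘ Equivalence.to H⇔R) (Equivalence.from H⇔R ∘ Equivalence.to B⇔R))

x∈tabulate⇔ : ∀ {f : Fin n → Bool} {x} → x ∈ tabulate f ⇔ f x ≡ true
x∈tabulate⇔ {f = f} {x} = mk⇔ (λ x∈ → trans (sym (lookup∘tabulate f x)) ([]=⇒lookup x∈))
                              (λ fx → lookup⇒[]= x _ (trans (lookup∘tabulate f x) fx))

module _ (A : Adjacency n) (S : Subset n) (v : Fin n) where

  NeighbourIn : Fin n → Set
  NeighbourIn u = A v u ≡ true × u ∈ S

  ∈N∩⇔ : ∀ {u} → u ∈ N A v ∩ S ⇔ NeighbourIn u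
  ∈N∩⇔ = mk⇔ (Prod.map₁ (Equivalence.to x∈tabulate⇔) ∘ x∈p∩q⁻ _ S)
             (x∈p∩q⁺ ∘ Prod.map₁ (Equivalence.from x∈tabulate⇔))

  neighbour⇒1≤degIn : ∀ {u} → NeighbourIn u → 1 ≤ degIn A S v
  neighbour⇒1≤degIn = x∈p⇒1≤∣p∣ ∘ Equivalence.from ∈N∩⇔

  1≤degIn⇒neighbour : 1 ≤ degIn A S v → ∃ NeighbourIn
  1≤degIn⇒neighbour 1≤deg with f , _ , f∈ ← ≤∣p∣⇒injection 1≤deg = f zero , Equivalence.to ∈N∩⇔ (f∈ zero)

  degIn≤2⇔ : degIn A S v ≤ 2 ⇔ AtMostTwo NeighbourIn
  degIn≤2⇔ = mk⇔ (AtMostTwo-mono (Equivalence.from ∈N∩⇔) ∘ ∣p∣≤2⇒AtMostTwo)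
                 (AtMostTwo⇒∣p∣≤2 ∘ AtMostTwo-mono (Equivalence.to ∈N∩⇔))

module Corona (H : Graph n) where

  open Edges H

  G : Adjacency (n + n)
  G = corona H

  inner leaf : Fin n → Fin (n + n)
  inner i = i ↑ˡ n
  leaf  i = n ↑ʳ i

  data Vertex : Fin (n + n) → Set where
    inner-vertex : ∀ i → Vertex (inner i)
    leaf-vertex  : ∀ i → Vertex (leaf i)

  vertex : ∀ u → Vertex u
  vertex u with splitAt n u in eq
  ... | inj₁ i = subst Vertex (Fin.splitAt⁻¹-↑ˡ eq) (inner-vertex i)
  ... | inj₂ i = subst Vertex (Fin.splitAt⁻¹-↑ʳ eq) (leaf-vertex i)

  inner-injective : ∀ {i j} → inner i ≡ inner j → i ≡ j
  inner-injective = Fin.↑ˡ-injective n _ _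

  owner : Fin (n + n) → Fin n
  owner u = Sum.[ id , id ] (splitAt n u)

  owner-inner : ∀ i → owner (inner i) ≡ i
  owner-inner i rewrite Fin.splitAt-↑ˡ n i n = refl

  owner-leaf : ∀ i → owner (leaf i) ≡ i
  owner-leaf i rewrite Fin.splitAt-↑ʳ n n i = refl

  inner-inner : ∀ i j → G (inner i) (inner j) ≡ adj H i j
  inner-inner i j rewrite Fin.splitAt-↑ˡ n i n | Fin.splitAt-↑ˡ n j n = refl

  leaf-inner : ∀ i j → G (leaf i) (inner j) ≡ ⌊ i Fin.≟ j ⌋
  leaf-inner i j rewrite Fin.splitAt-↑ʳ n n i | Fin.splitAt-↑ˡ n j n = refl

  leaf-leaf : ∀ i j → G (leaf i) (leaf j) ≡ false
  leaf-leaf i j rewrite Fin.splitAt-↑ʳ n n i | Fin.splitAt-↑ʳ n n j = refl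

  leaf~inner : ∀ i → G (leaf i) (inner i) ≡ true
  leaf~inner i = trans (leaf-inner i i) (Equivalence.to T-≡ (fromWitness {a? = i Fin.≟ i} refl))

  leaf-neighbour : ∀ {i u} → G (leaf i) u ≡ true → u ≡ inner i
  leaf-neighbour {i} {u} e with vertex u
  ... | inner-vertex j = cong inner (sym (toWitness {a? = i Fin.≟ j}
                           (Equivalence.from T-≡ (trans (sym (leaf-inner i j)) e))))
  ... | leaf-vertex j = contradiction (trans (sym (leaf-leaf i j)) e) λ ()

  leaf-degIn≤2 : ∀ S i → degIn G S (leaf i) ≤ 2
  leaf-degIn≤2 S i = Equivalence.from (degIn≤2⇔ G S (leaf i))
    λ (x~ , _) (y~ , _) _ → inj₁ (trans (leaf-neighbour x~) (sym (leaf-neighbour y~)))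

  dominated-leaf⇒inner∈ : ∀ {S i} → 1 ≤ degIn G S (leaf i) → inner i ∈ S
  dominated-leaf⇒inner∈ 1≤deg with u , leaf~u , u∈S ← 1≤degIn⇒neighbour G _ _ 1≤deg =
    subst (_∈ _) (leaf-neighbour leaf~u) u∈S

  Is12Set⇒n≤∣S∣ : ∀ {S} → Is12Set G S → n ≤ ∣ S ∣
  Is12Set⇒n≤∣S∣ {S} is12 =
    injection⇒≤∣p∣ (proj₁ ∘ representative , representative-injective , proj₁ ∘ proj₂ ∘ representative)
    where
    representative : ∀ i → ∃ λ u → u ∈ S × owner u ≡ i
    representative i with leaf i ∈? S
    ... | yes leaf∈S = leaf i , leaf∈S , owner-leaf i
    ... | no  leaf∉S = inner i , dominated-leaf⇒inner∈ (proj₁ (is12 (leaf i) leaf∉S)) , owner-inner i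
    representative-injective : Injective _≡_ _≡_ (proj₁ ∘ representative)
    representative-injective {i} {j} eq =
      trans (sym (proj₂ (proj₂ (representative i))))
            (trans (cong owner eq) (proj₂ (proj₂ (representative j))))

  V : Subset (n + n)
  V = ⊤ {n} ++ ⊥ {n}

  ∣V∣≡n : ∣ V ∣ ≡ n
  ∣V∣≡n = trans (∣p++q∣≡∣p∣+∣q∣ (⊤ {n}) (⊥ {n})) (trans (cong₂ _+_ (∣⊤∣≡n n) (∣⊥∣≡0 n)) (ℕ.+-identityʳ n))

  inner∈V : ∀ i → inner i ∈ V
  inner∈V i = lookup⇒[]= (inner i) V (trans (lookup-++ˡ (⊤ {n}) (⊥ {n}) i) (lookup-replicate i inside))

  leaf∉V : ∀ i → leaf i ∉ V
  leaf∉V i leaf∈V =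
    contradiction (trans (sym ([]=⇒lookup leaf∈V))
                         (trans (lookup-++ʳ (⊤ {n}) (⊥ {n}) i) (lookup-replicate i outside))) λ ()

  leaf-degIn-V : ∀ i → (1 ≤ degIn G V (leaf i)) × (degIn G V (leaf i) ≤ 2)
  leaf-degIn-V i = neighbour⇒1≤degIn G V (leaf i) (leaf~inner i , inner∈V i) , leaf-degIn≤2 V i

  V-Is12Set : Is12Set G V
  V-Is12Set u u∉V with vertex u
  ... | inner-vertex i = contradiction (inner∈V i) u∉V
  ... | leaf-vertex  i = leaf-degIn-V i

  inner-neighbour-in-V : ∀ {i u} → NeighbourIn G V (inner i) u → ∃ λ j → u ≡ inner j × i ~ j
  inner-neighbour-in-V {i} {u} (e , u∈V) with vertex u
  ... | inner-vertex j = j , refl , trans (sym (inner-inner i j)) e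
  ... | leaf-vertex  j = contradiction u∈V (leaf∉V j)

  V-IsT12Set : (∀ i → ∃ (i ~_)) → MaxDegree≤2 (adj H) → IsT12Set G V
  V-IsT12Set nb Δ≤2 u with vertex u
  ... | leaf-vertex  i = leaf-degIn-V i
  ... | inner-vertex i =
      neighbour⇒1≤degIn G V (inner i) (trans (inner-inner i j) i~j , inner∈V j)
    , Equivalence.from (degIn≤2⇔ G V (inner i)) at-most-two
    where
    j = proj₁ (nb i)
    i~j = proj₂ (nb i)
    at-most-two : AtMostTwo (NeighbourIn G V (inner i))
    at-most-two x y z
      with _ , refl , i~x ← inner-neighbour-in-V x | _ , refl , i~y ← inner-neighbour-in-V y
         | _ , refl , i~z ← inner-neighbour-in-V z
      = Sum.map (cong inner) (Sum.map (cong inner) (cong inner)) (Δ≤2 i i~x i~y i~z)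

  IsT12Set⇒MaxDegree≤2 : ∀ {S} → IsT12Set G S → MaxDegree≤2 (adj H)
  IsT12Set⇒MaxDegree≤2 {S} isT12 v v~a v~b v~c =
    Sum.map inner-injective (Sum.map inner-injective inner-injective)
      (Equivalence.to (degIn≤2⇔ G S (inner v)) (proj₂ (isT12 (inner v)))
        (lift v~a) (lift v~b) (lift v~c))
    where
    lift : ∀ {x} → v ~ x → NeighbourIn G S (inner v) (inner x)
    lift {x} v~x = trans (inner-inner v x) v~x , dominated-leaf⇒inner∈ (proj₁ (isT12 (leaf x)))

  γt[1,2]≡γ[1,2] : (∀ i → ∃ (i ~_)) → MaxDegree≤2 (adj H) → GammaT12≡Gamma12 G
  γt[1,2]≡γ[1,2] nb Δ≤2 = n , ((V , V-Is12Set , ∣V∣≡n) , λ _ → Is12Set⇒n≤∣S∣)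
                     , ((V , V-IsT12Set nb Δ≤2 , ∣V∣≡n) , λ _ isT12 → Is12Set⇒n≤∣S∣ (λ v _ → isT12 v))

module NonBacktrackingWalk (H : Graph n) (conn : Connected H) (Δ≤2 : MaxDegree≤2 (adj H))
                           {s t : Fin n} (s~t : adj H s t ≡ true) where

  open Edges H

  Branches : Fin n → Fin n → Set
  Branches p c = ∃ λ y → c ~ y × y ≢ p

  branches? : ∀ p c → Dec (Branches p c)
  branches? p c = any? λ y → (adj H c y Bool.≟ true) ×-dec ¬? (y Fin.≟ p)

  -- The fallback c, taken when c has no neighbour other than p, is a junk value that the simple
  -- prefixes below never reach.
  next : Fin n → Fin n → Fin n
  next p c with branches? p c
  ... | yes (y , _) = y
  ... | no  _       = c

  next-branches : ∀ {p c} → Branches p c → c ~ next p c × next p c ≢ p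
  next-branches {p} {c} br with branches? p c
  ... | yes (_ , c~y , y≢p) = c~y , y≢p
  ... | no  ¬br             = contradiction br ¬br

  walk : ℕ → Fin n
  walk zero          = s
  walk (suc zero)    = t
  walk (suc (suc i)) = next (walk i) (walk (suc i))

  Distinct Linked Simple : ℕ → Set
  Distinct k = ∀ {i j} → i < j → j < k → walk i ≢ walk j
  Linked   k = ∀ {i} → suc i < k → walk i ~ walk (suc i)
  Simple   k = Distinct k × Linked k

  simple-2 : Simple 2
  simple-2 = distinct , linked
    where
    distinct : Distinct 2
    distinct {zero}  {suc zero}    _        _ = ~-irrefl s~t
    distinct {suc _} {suc zero}    (s≤s ()) _
    distinct {_}     {suc (suc _)} _        (s≤s (s≤s ()))
    linked : Linked 2
    linked {zero}  _ = s~t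
    linked {suc _} (s≤s (s≤s ()))

  walk-injective : ∀ {k i j} → Distinct k → i < k → j < k → walk i ≡ walk j → i ≡ j
  walk-injective {i = i} {j} distinct i<k j<k eq with ℕ.<-cmp i j
  ... | tri< i<j _ _ = contradiction eq (distinct i<j j<k)
  ... | tri≈ _ i≡j _ = i≡j
  ... | tri> _ _ j<i = contradiction (sym eq) (distinct j<i i<k)

  interior-neighbours : ∀ {k i y} → Simple k → suc (suc i) < k →
    walk (suc i) ~ y → y ≡ walk i ⊎ y ≡ walk (suc (suc i))
  interior-neighbours {i = i} (distinct , linked) i+2<k =
    neighbours-of Δ≤2 (distinct (ℕ.m<n⇒m<1+n (ℕ.n<1+n i)) i+2<k)
      (~-sym (linked (ℕ.m+n≤o⇒n≤o 1 i+2<k))) (linked i+2<k)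

  chord⇒ends : ∀ {k i j} → Simple k → suc i < j → j < k → walk i ~ walk j → i ≡ 0 × suc j ≡ k
  chord⇒ends {i = suc i} simple@(distinct , _) i+2<j j<k wi+1~wj
    with interior-neighbours simple (ℕ.<-trans i+2<j j<k) wi+1~wj
  ... | inj₁ wj≡wi   = contradiction (sym wj≡wi) (distinct (ℕ.m+n≤o⇒n≤o 2 i+2<j) j<k)
  ... | inj₂ wj≡wi+2 = contradiction (sym wj≡wi+2) (distinct i+2<j j<k)
  chord⇒ends {i = zero} {suc j} simple@(distinct , _) (s≤s 1≤j) j+1<k s~wj+1
    with ℕ.m≤n⇒m<n∨m≡n j+1<k
  ... | inj₂ j+2≡k = refl , j+2≡k
  ... | inj₁ j+2<k with interior-neighbours simple j+2<k (~-sym s~wj+1)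
  ...   | inj₁ s≡wj   = contradiction s≡wj (distinct 1≤j (ℕ.m+n≤o⇒n≤o 2 j+2<k))
  ...   | inj₂ s≡wj+2 = contradiction s≡wj+2 (distinct (s≤s z≤n) j+2<k)

  back-edge : ∀ {m i} → Simple (2 + m) → i < 2 + m →
    walk (suc m) ~ walk i → walk i ≢ walk m → i ≡ 0 × 1 ≤ m
  back-edge {m} {i} simple i<2+m wm+1~wi wi≢wm with ℕ.m≤n⇒m<n∨m≡n (ℕ.≤-pred i<2+m)
  ... | inj₂ refl = contradiction refl (~-irrefl wm+1~wi)
  ... | inj₁ i<m+1 with ℕ.m≤n⇒m<n∨m≡n (ℕ.≤-pred i<m+1)
  ...   | inj₂ refl = contradiction refl wi≢wm
  ...   | inj₁ i<m with chord⇒ends simple (s≤s i<m) (ℕ.n<1+n (suc m)) (~-sym wm+1~wi)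
  ...     | refl , _ = refl , i<m

  extend : ∀ {m} → Simple (2 + m) → Branches (walk m) (walk (suc m)) →
    (1 ≤ m → ¬ s ~ walk (suc m)) → Simple (3 + m)
  extend {m} simple@(distinct , linked) br no-return = distinct′ , linked′
    where
    new-edge : walk (suc m) ~ walk (2 + m)
    new-edge = proj₁ (next-branches br)
    not-back : walk (2 + m) ≢ walk m
    not-back = proj₂ (next-branches br)
    fresh : ∀ {i} → i < 2 + m → walk i ≢ walk (2 + m)
    fresh i<2+m wi≡new =
      let wm+1~wi   = subst (walk (suc m) ~_) (sym wi≡new) new-edge
          i≡0 , 1≤m = back-edge simple i<2+m wm+1~wi (not-back ∘ trans (sym wi≡new))
      in  no-return 1≤m (~-sym (subst (λ i → walk (suc m) ~ walk i) i≡0 wm+1~wi))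
    distinct′ : Distinct (3 + m)
    distinct′ i<j j<3+m with ℕ.m≤n⇒m<n∨m≡n (ℕ.≤-pred j<3+m)
    ... | inj₁ j<2+m = distinct i<j j<2+m
    ... | inj₂ refl  = fresh i<j
    linked′ : Linked (3 + m)
    linked′ i+1<3+m with ℕ.m≤n⇒m<n∨m≡n (ℕ.≤-pred i+1<3+m)
    ... | inj₁ i+1<2+m = linked i+1<2+m
    ... | inj₂ refl    = new-edge

  InPrefix : ℕ → Fin n → Set
  InPrefix k y = ∃ λ j → j < k × walk j ≡ y

  Closed : ℕ → Set
  Closed k = ∀ {i y} → i < k → walk i ~ y → InPrefix k y

  -- By connectivity a closed nonempty prefix visits every vertex.
  closed⇒n≤ : ∀ {k} → 1 ≤ k → Closed k → n ≤ k
  closed⇒n≤ {k} 1≤k closed = strictlySurjective⇒≤ {f = walk ∘ toℕ} onto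
    where
    everywhere : ∀ v → InPrefix k v
    everywhere v =
      reach-closed (InPrefix k) (λ { (_ , j<k , refl) e → closed j<k e }) (conn s v) (0 , 1≤k , refl)
    onto : StrictlySurjective _≡_ (walk ∘ toℕ {k})
    onto v with j , j<k , refl ← everywhere v = Fin.fromℕ< j<k , cong walk (Fin.toℕ-fromℕ< j<k)

  ends-closed⇒closed : ∀ {m} → Simple (2 + m) →
    (∀ {y} → s ~ y → InPrefix (2 + m) y) → (∀ {y} → walk (suc m) ~ y → InPrefix (2 + m) y) →
    Closed (2 + m)
  ends-closed⇒closed _ first-closed _ {zero} _ s~y = first-closed s~y
  ends-closed⇒closed simple _ last-closed {suc i} i+1<2+m wi+1~y with ℕ.m≤n⇒m<n∨m≡n i+1<2+m
  ... | inj₂ refl  = last-closed wi+1~y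
  ... | inj₁ i+2<k with interior-neighbours simple i+2<k wi+1~y
  ...   | inj₁ y≡wi   = _ , ℕ.m+n≤o⇒n≤o 2 i+2<k , sym y≡wi
  ...   | inj₂ y≡wi+2 = _ , i+2<k , sym y≡wi+2

  simple-walk : (∀ {m} → Simple (2 + m) → 2 + m < n → Branches (walk m) (walk (suc m))) →
    (∀ {m} → Simple (2 + m) → 2 + m < n → 1 ≤ m → ¬ s ~ walk (suc m)) → 2 ≤ n → Simple n
  simple-walk branch no-return 2≤n =
    subst Simple (ℕ.m+[n∸m]≡n 2≤n) (grow (n ∸ 2) (ℕ.≤-reflexive (ℕ.m+[n∸m]≡n 2≤n)))
    where
    grow : ∀ m → 2 + m ≤ n → Simple (2 + m)
    grow zero    _     = simple-2
    grow (suc m) 3+m≤n = extend simple (branch simple 3+m≤n) (no-return simple 3+m≤n)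
      where simple = grow m (ℕ.<⇒≤ 3+m≤n)

  σ : Fin n → Fin n
  σ i = walk (toℕ i)

  σ-injective : Distinct n → Injective _≡_ _≡_ σ
  σ-injective distinct = toℕ-injective ∘ walk-injective distinct (Fin.toℕ<n _) (Fin.toℕ<n _)

  σ-bijection : Distinct n → Fin n ⤖ Fin n
  σ-bijection distinct = mk⤖ (σ-injective distinct ,
    strictlySurjective⇒surjective (injective⇒strictlySurjective (σ-injective distinct)))

  σ-edge⇐succ : Linked n → ∀ {i j} → toℕ j ≡ suc (toℕ i) → σ i ~ σ j
  σ-edge⇐succ linked {i} {j} j≡1+i =
    subst (λ k → σ i ~ walk k) (sym j≡1+i) (linked (subst (_< n) j≡1+i (Fin.toℕ<n j)))

  ascending-σ-edge : Simple n → ∀ {i j} → toℕ i < toℕ j → σ i ~ σ j → CycleStep i j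
  ascending-σ-edge simple i<j σi~σj with ℕ.m≤n⇒m<n∨m≡n i<j
  ... | inj₂ 1+i≡j = inj₁ (inj₁ (sym 1+i≡j))
  ... | inj₁ 1+i<j with chord⇒ends simple 1+i<j (Fin.toℕ<n _) σi~σj
  ...   | i≡0 , 1+j≡n = inj₂ (inj₂ (1+j≡n , i≡0))

  σ-edge⇒CycleStep : Simple n → ∀ {i j} → σ i ~ σ j → CycleStep i j
  σ-edge⇒CycleStep simple {i} {j} σi~σj with ℕ.<-cmp (toℕ i) (toℕ j)
  ... | tri< i<j _ _ = ascending-σ-edge simple i<j σi~σj
  ... | tri≈ _ i≡j _ = contradiction (cong walk i≡j) (~-irrefl σi~σj)
  ... | tri> _ _ j<i = Sum.swap (ascending-σ-edge simple j<i (~-sym σi~σj))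

module PathCase (H : Graph n) (conn : Connected H) (Δ≤2 : MaxDegree≤2 (adj H)) (2≤n : 2 ≤ n)
                {s t : Fin n} (s~t : adj H s t ≡ true) (s-pendant : ∀ {y} → adj H s y ≡ true → y ≡ t) where

  open Edges H
  open NonBacktrackingWalk H conn Δ≤2 s~t

  branch : ∀ {m} → Simple (2 + m) → 2 + m < n → Branches (walk m) (walk (suc m))
  branch {m} simple 2+m<n with branches? (walk m) (walk (suc m))
  ... | yes br = br
  ... | no ¬br = contradiction (closed⇒n≤ (s≤s z≤n) (ends-closed⇒closed simple first-closed last-closed))
                               (ℕ.<⇒≱ 2+m<n)
    where
    first-closed : ∀ {y} → s ~ y → InPrefix (2 + m) y
    first-closed s~y = 1 , s≤s (s≤s z≤n) , sym (s-pendant s~y)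
    last-closed : ∀ {y} → walk (suc m) ~ y → InPrefix (2 + m) y
    last-closed {y} wm+1~y with y Fin.≟ walk m
    ... | yes y≡wm = m , ℕ.m<n⇒m<1+n (ℕ.n<1+n m) , sym y≡wm
    ... | no  y≢wm = contradiction (y , wm+1~y , y≢wm) ¬br

  no-return : ∀ {m} → Simple (2 + m) → 2 + m < n → 1 ≤ m → ¬ s ~ walk (suc m)
  no-return {m} (distinct , _) _ 1≤m s~wm+1 = distinct (s≤s 1≤m) (ℕ.n<1+n (suc m)) (sym (s-pendant s~wm+1))

  simple : Simple n
  simple = simple-walk branch no-return 2≤n

  succ⇒PathStep : ∀ {i j} → σ i ~ σ j → CyclicSucc i j → PathStep i j
  succ⇒PathStep _ (inj₁ j≡1+i) = inj₁ j≡1+i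
  succ⇒PathStep {i} σi~σj (inj₂ (_ , j≡0)) = inj₂ (trans i≡1 (cong suc (sym j≡0)))
    where
    σi≡t : σ i ≡ t
    σi≡t = s-pendant (~-sym (subst (σ i ~_) (cong walk j≡0) σi~σj))
    i≡1 : toℕ i ≡ 1
    i≡1 = walk-injective (proj₁ simple) (Fin.toℕ<n i) 2≤n σi≡t

  isPath : IsPath H
  isPath = IsoTo-intro {H = H} {R = PathStep} (σ-bijection (proj₁ simple)) σ-edge⇔ T-pathAdj
    where
    σ-edge⇔ : ∀ {i j} → σ i ~ σ j ⇔ PathStep i j
    σ-edge⇔ = mk⇔ (λ σi~σj → Sum.[ succ⇒PathStep σi~σj , Sum.swap ∘ succ⇒PathStep (~-sym σi~σj) ]′
                               (σ-edge⇒CycleStep simple σi~σj))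
                  Sum.[ σ-edge⇐succ (proj₂ simple) , ~-sym ∘ σ-edge⇐succ (proj₂ simple) ]′

TwoNeighbours : Graph n → Fin n → Set
TwoNeighbours H v = ∃₂ λ a b → a ≢ b × adj H v a ≡ true × adj H v b ≡ true

TwoNeighbours? : ∀ (H : Graph n) v → Dec (TwoNeighbours H v)
TwoNeighbours? H v = any? λ a → any? λ b →
  ¬? (a Fin.≟ b) ×-dec (adj H v a Bool.≟ true) ×-dec (adj H v b Bool.≟ true)

module CycleCase (H : Graph n) (conn : Connected H) (Δ≤2 : MaxDegree≤2 (adj H)) (2≤n : 2 ≤ n)
                 {s t : Fin n} (s~t : adj H s t ≡ true) (two : ∀ v → TwoNeighbours H v) where

  open Edges H
  open NonBacktrackingWalk H conn Δ≤2 s~t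

  branch : ∀ p c → Branches p c
  branch p c with two c
  ... | a , b , a≢b , c~a , c~b with a Fin.≟ p
  ...   | yes a≡p = b , c~b , λ b≡p → a≢b (trans a≡p (sym b≡p))
  ...   | no  a≢p = a , c~a , a≢p

  no-return : ∀ {m} → Simple (2 + m) → 2 + m < n → 1 ≤ m → ¬ s ~ walk (suc m)
  no-return {m} simple@(distinct , linked) 2+m<n 1≤m s~wm+1 =
    contradiction (closed⇒n≤ (s≤s z≤n) (ends-closed⇒closed simple first-closed last-closed)) (ℕ.<⇒≱ 2+m<n)
    where
    first-closed : ∀ {y} → s ~ y → InPrefix (2 + m) y
    first-closed s~y with neighbours-of Δ≤2 (distinct (s≤s 1≤m) (ℕ.n<1+n (suc m))) s~t s~wm+1 s~y
    ... | inj₁ y≡t    = 1 , s≤s (s≤s z≤n) , sym y≡t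
    ... | inj₂ y≡wm+1 = suc m , ℕ.n<1+n (suc m) , sym y≡wm+1
    last-closed : ∀ {y} → walk (suc m) ~ y → InPrefix (2 + m) y
    last-closed wm+1~y with neighbours-of Δ≤2 (distinct 1≤m (ℕ.m<n⇒m<1+n (ℕ.n<1+n m)) ∘ sym)
                              (~-sym (linked (ℕ.n<1+n (suc m)))) (~-sym s~wm+1) wm+1~y
    ... | inj₁ y≡wm = m , ℕ.m<n⇒m<1+n (ℕ.n<1+n m) , sym y≡wm
    ... | inj₂ y≡s  = 0 , s≤s z≤n , sym y≡s

  simple : Simple n
  simple = simple-walk (λ _ _ → branch _ _) no-return 2≤n

  3≤n : 3 ≤ n
  3≤n with a , b , a≢b , s~a , s~b ← two s = three-distinct⇒3≤n a≢b (~-irrefl s~a ∘ sym) (~-irrefl s~b ∘ sym)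

  -- The last vertex has a neighbour besides its predecessor; every vertex is already on the walk,
  -- so by back-edge that neighbour is s.
  closing-edge : ∀ {k} → suc k ≡ n → walk k ~ s
  closing-edge {zero} 1≡n = contradiction (subst (2 ≤_) (sym 1≡n) 2≤n) λ { (s≤s ()) }
  closing-edge {suc m} 2+m≡n with y , wm+1~y , y≢wm ← branch (walk m) (walk (suc m))
    with i , refl ← injective⇒strictlySurjective (σ-injective (proj₁ simple)) y
    with back-edge (subst Simple (sym 2+m≡n) simple) (subst (toℕ i <_) (sym 2+m≡n) (Fin.toℕ<n i))
                   wm+1~y y≢wm
  ... | i≡0 , _ = subst (walk (suc m) ~_) (cong walk i≡0) wm+1~y

  isCycle : IsCycle H
  isCycle = 3≤n , IsoTo-intro {H = H} {R = CycleStep} (σ-bijection (proj₁ simple)) σ-edge⇔ T-cycleAdj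
    where
    succ⇒σ-edge : ∀ {i j} → CyclicSucc i j → σ i ~ σ j
    succ⇒σ-edge (inj₁ j≡1+i)      = σ-edge⇐succ (proj₂ simple) j≡1+i
    succ⇒σ-edge (inj₂ (1+i≡n , j≡0)) = subst (_ ~_) (cong walk (sym j≡0)) (closing-edge 1+i≡n)
    σ-edge⇔ : ∀ {i j} → σ i ~ σ j ⇔ CycleStep i j
    σ-edge⇔ = mk⇔ (σ-edge⇒CycleStep simple) Sum.[ succ⇒σ-edge , ~-sym ∘ succ⇒σ-edge ]′

connected-MaxDegree≤2⇒path-or-cycle : ∀ {H : Graph n} → Connected H → 2 ≤ n → MaxDegree≤2 (adj H) →
  IsPath H ⊎ IsCycle H
connected-MaxDegree≤2⇒path-or-cycle {n} {H} conn 2≤n@(s≤s (s≤s _)) Δ≤2 with Fin.all? (TwoNeighbours? H)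
... | yes all-two = inj₂ (CycleCase.isCycle H conn Δ≤2 2≤n (proj₂ (neighbour zero)) all-two)
  where neighbour = Edges.connected⇒neighbour H 2≤n conn
... | no ¬all-two with v , ¬two ← Fin.¬∀⟶∃¬ n _ (TwoNeighbours? H) ¬all-two =
  inj₁ (PathCase.isPath H conn Δ≤2 2≤n v~t pendant)
  where
  t   = proj₁ (Edges.connected⇒neighbour H 2≤n conn v)
  v~t = proj₂ (Edges.connected⇒neighbour H 2≤n conn v)
  pendant : ∀ {y} → adj H v y ≡ true → y ≡ t
  pendant {y} v~y with y Fin.≟ t
  ... | yes y≡t = y≡t
  ... | no  y≢t = contradiction (y , t , y≢t , v~y , v~t) ¬two

IsPath⊎IsCycle⇒MaxDegree≤2 : ∀ {H : Graph n} → IsPath H ⊎ IsCycle H → MaxDegree≤2 (adj H)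
IsPath⊎IsCycle⇒MaxDegree≤2 {H = H} (inj₁ path) = IsoTo⇒MaxDegree≤2 {H = H} path pathAdj-MaxDegree≤2
IsPath⊎IsCycle⇒MaxDegree≤2 {H = H} (inj₂ (_ , cycle)) = IsoTo⇒MaxDegree≤2 {H = H} cycle cycleAdj-MaxDegree≤2

theorem4p1 : ∀ {n} (H : Graph n) → 2 ≤ n → Connected H →
    (GammaT12≡Gamma12 (corona H) → IsPath H ⊎ IsCycle H)
    × (IsPath H ⊎ IsCycle H → GammaT12≡Gamma12 (corona H))
theorem4p1 H 2≤n conn =
    (λ (_ , _ , (T , isT12 , _) , _) →
      connected-MaxDegree≤2⇒path-or-cycle conn 2≤n (IsT12Set⇒MaxDegree≤2 isT12))
  , γt[1,2]≡γ[1,2] (connected⇒neighbour 2≤n conn) ∘ IsPath⊎IsCycle⇒MaxDegree≤2 {H = H}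
  where
  open Edges H using (connected⇒neighbour)
  open Corona H using (IsT12Set⇒MaxDegree≤2; γt[1,2]≡γ[1,2])
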